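{- Let $k$ be a power of a prime and let $S\subseteq\mathcal{L}_k$ be nonempty. If an $n$-vertex graph $G$ with $m$ edges is $S$-$k$-colorable and $m\le (k-1)n$, then $$P_S(G,k)\ge k^{\,n-\frac{m}{k-1}}.$$ In particular, $P_{\mathcal{L}_k}(G,k)\ge k^{\,n-\frac{m}{k-1}}$ whenever $G$ is $\mathcal{L}_k$-$k$-colorable and $m\le(k-1)n$.
   Context: $\mathbb{F}_k$ is the finite field with $k$ elements. A polynomial $f\in\mathbb{F}_k[x,y]$ covers a permutation $\pi$ of $\mathbb{F}_k$ if $f(x,\pi(x))=0$ for all $x\in\mathbb{F}_k$; $\pi$ is $\mathbb{F}_k$-linear if some polynomial of degree one in $\mathbb{F}_k[x,y]$ covers it. $\mathcal{L}_k\subseteq S_{\mathbb{F}_k}$ is the set of $\mathbb{F}_k$-linear permutations. For a finite set $A$ and nonempty $S\subseteq S_A$ (here $A=\mathbb{F}_k$), an $S$-labeling of a graph $G$ is a pair $(D,\sigma)$ with $D$ an orientation of $G$ and $\sigma:E(D)\to S$ (for multigraphs, $D$ orients the underlying simple graph and $\sigma(u,v)$ is a tuple of elements of $S$, one per parallel edge). A proper $S$-coloring of $(D,\sigma)$ is $\kappa:V(G)\to A$ with $\pi(\kappa(u))\ne\kappa(v)$ for every arc $(u,v)$ and every permutation $\pi$ assigned to it; it is a proper $S$-$k$-coloring if it uses at most $k$ colors. $G$ is $S$-$k$-colorable if every $S$-labeling of $G$ has a proper $S$-$k$-coloring. $P_S(G,k)$ is the minimum over all $S$-labelings of $G$ of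 the number of proper $S$-$k$-colorings. -}

module Defs where

open import Level using (0ℓ)
open import Data.Nat using (ℕ; zero; suc; _^_)
open import Data.Nat.Primality using (Prime)
open import Data.Fin using (Fin)
open import Data.Fin.Properties using (_≟_; all?)
open import Data.Vec using (Vec; []; _∷_; lookup)
open import Data.List using (List; []; _∷_; length; filter; concatMap; map)
import Data.List as L
open import Data.Fin using (zero; suc)
open import Data.Bool using (Bool; true; false; not)
open import Data.Product using (_×_; _,_; proj₁; proj₂; Σ; ∃; ∃₂)
open import Data.Sum using (_⊎_)
open import Function.Bundles using (_↔_; Inverse)
open import Relation.Binary.PropositionalEquality using (_≡_; _≢_)
open import Relation.Nullary using (Dec; ¬_)
open import Relation.Nullary.Decidable using (¬?)
open import Algebra.Structures using (IsCommutativeRing)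

IsPrimePower : ℕ → Set
IsPrimePower k = ∃₂ λ p e → Prime p × k ≡ p ^ suc e

-- A field structure on the k-element set Fin k (propositional equality).
-- Any field with k elements is (isomorphic to) one of these.
record FiniteField (k : ℕ) : Set where
  field
    _+_ _*_ : Fin k → Fin k → Fin k
    -_      : Fin k → Fin k
    0# 1#   : Fin k
    isCommutativeRing : IsCommutativeRing _≡_ _+_ _*_ -_ 0# 1#
    0≢1     : 0# ≢ 1#
    inverse : ∀ x → x ≢ 0# → Σ (Fin k) λ y → x * y ≡ 1#

Perm : ℕ → Set
Perm k = Fin k ↔ Fin k

apply : ∀ {k} → Perm k → Fin k → Fin k
apply π = Inverse.to π

module _ {k : ℕ} (F : FiniteField k) where
  open FiniteField F

  -- the polynomial a x + b y + c has degree one iff (a , b) ≠ (0 , 0);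
  -- it covers π iff a x + b π(x) + c = 0 for all x.
  Covers : Fin k → Fin k → Fin k → Perm k → Set
  Covers a b c π = ∀ x → (a * x) + ((b * apply π x) + c) ≡ 0#

  IsLinear : Perm k → Set
  IsLinear π = Σ (Fin k) λ a → Σ (Fin k) λ b → Σ (Fin k) λ c →
               ¬ (a ≡ 0# × b ≡ 0#) × Covers a b c π

record Multigraph (n : ℕ) : Set where
  field
    edges    : List (Fin n × Fin n)
    loopless : ∀ i → proj₁ (L.lookup edges i) ≢ proj₂ (L.lookup edges i)

open Multigraph public

numEdges : ∀ {n} → Multigraph n → ℕ
numEdges G = length (edges G)

-- An S-labeling (D , σ): D is an orientation of the underlying simple graph
-- (given by `orient u v = true` meaning the arc goes u → v; antisymmetric, so
-- all parallel edges between u and v get the same direction), and σ assigns to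
-- every edge (each parallel copy separately) a permutation from S.
record Labeling {k n : ℕ} (S : Perm k → Set) (G : Multigraph n) : Set where
  field
    orient  : Fin n → Fin n → Bool
    antisym : ∀ u v → u ≢ v → orient v u ≡ not (orient u v)
    σ       : Fin (numEdges G) → Perm k
    σ∈S     : ∀ i → S (σ i)

  arc : Fin (numEdges G) → Fin n × Fin n
  arc i with L.lookup (edges G) i
  ... | (u , v) with orient u v
  ...   | true  = (u , v)
  ...   | false = (v , u)

open Labeling public

Proper : ∀ {k n} {S : Perm k → Set} {G : Multigraph n} →
         Labeling S G → (Fin n → Fin k) → Set
Proper ℓ κ = ∀ i → apply (σ ℓ i) (κ (proj₁ (arc ℓ i))) ≢ κ (proj₂ (arc ℓ i))

proper? : ∀ {k n} {S : Perm k → Set} {G : Multigraph n} →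
          (ℓ : Labeling S G) → (κ : Fin n → Fin k) → Dec (Proper ℓ κ)
proper? ℓ κ = all? λ i → ¬? (apply (σ ℓ i) (κ (proj₁ (arc ℓ i))) ≟ κ (proj₂ (arc ℓ i)))

allFin : (k : ℕ) → List (Fin k)
allFin zero    = []
allFin (suc k) = zero ∷ map suc (allFin k)

allVecs : (n k : ℕ) → List (Vec (Fin k) n)
allVecs zero    k = [] ∷ []
allVecs (suc n) k = concatMap (λ v → map (_∷ v) (allFin k)) (allVecs n k)

numProper : ∀ {k n} {S : Perm k → Set} {G : Multigraph n} → Labeling S G → ℕ
numProper {k} {n} ℓ = length (filter (λ v → proper? ℓ (lookup v)) (allVecs n k))

Colorable : ∀ {k n} (S : Perm k → Set) (G : Multigraph n) → Set
Colorable S G = (ℓ : Labeling S G) → Σ _ λ κ → Proper ℓ κ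

-- Fix a proper colouring κ, which exists by colourability. Every arc (u , v) carries a
-- permutation π covered by a x + b y + c with b ≠ 0, so π (κ u) ≠ κ v iff the edge form
-- a κ(u) + b κ(v) + c is nonzero. The proper colourings are therefore the nonzeros of the
-- product of the m edge forms, a polynomial function on F_k^n of degree at most m that does not
-- vanish at κ, and the Alon–Füredi bound yields at least k ^ (n − m / (k − 1)) of them.
-- That bound is proved by induction on n: expand in the first variable y with y-degree below k
-- and take the top coefficient g_t that is not identically zero. It has degree at most m − t,
-- each fibre over a nonzero of g_t has at least k − t nonzeros, and (1 + q) ^ s ≤ (1 + s) ^ q
-- for s = k − 1 − t ≤ q = k − 1 turns the factor k − t into the required power of k.

module Submission where

open import Defs
open import Level using (0ℓ)
open import Algebra.Bundles using (CommutativeRing)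
import Algebra.Solver.Ring.NaturalCoefficients.Default as NaturalCoefficients
open import Data.Empty using (⊥-elim)
open import Data.Fin as Fin using (Fin; toℕ)
open import Data.Fin.Properties using (_≟_; any?; toℕ≤pred[n]; ¬Fin0; suc-injective)
open import Data.List using (List; []; _∷_; length; filter; map; concatMap; _++_)
open import Data.List.Properties
  using (filter-≐; filter-none; filter-accept; filter-++; length-++; length-map)
open import Data.List.Relation.Unary.All using (universal)
open import Data.Nat hiding (_≟_)
open import Data.Nat.Properties hiding (_≟_; suc-injective)
open import Data.Nat.Tactic.RingSolver using (solve-∀)
open import Algebra.Properties.CommutativeSemigroup +-commutativeSemigroup
  using () renaming (interchange to +-interchange)
open import Algebra.Properties.CommutativeSemigroup *-commutativeSemigroup
  using () renaming (interchange to *-interchange)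
open import Data.Product using (Σ; Σ-syntax; ∃; _×_; _,_; proj₁; proj₂)
open import Data.Sum using (_⊎_; inj₁; inj₂)
open import Data.Unit using (⊤; tt)
open import Data.Vec as V using (Vec; []; _∷_; lookup; tabulate; replicate; zipWith)
open import Data.Vec.Properties using (lookup-map; lookup-replicate; lookup∘tabulate)
open import Data.Vec.Relation.Unary.Any using (Any; here; there)
open import Data.Vec.Relation.Unary.Any.Properties using (tabulate⁺)
open import Function using (id; _∘_)
open import Relation.Binary.PropositionalEquality
open import Relation.Nullary using (¬_; Dec; yes; no; contradiction)
open import Relation.Nullary.Decidable using (¬?; decidable-stable; map′)
open import Relation.Unary using (Pred; Decidable; _≐_)

[1+u]^s≤[1+s]*u^s : ∀ s u → s ≤ u → suc u ^ s ≤ suc s * u ^ s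
[1+u]^s≤[1+s]*u^s zero    u _   = ≤-refl
[1+u]^s≤[1+s]*u^s (suc s) u s<u = begin
  suc u * suc u ^ s         ≤⟨ *-monoʳ-≤ (suc u) ([1+u]^s≤[1+s]*u^s s u (<⇒≤ s<u)) ⟩
  suc u * (suc s * u ^ s)   ≡⟨ *-assoc (suc u) (suc s) (u ^ s) ⟨
  suc u * suc s * u ^ s     ≤⟨ *-monoˡ-≤ (u ^ s) (step s<u) ⟩
  suc (suc s) * u * u ^ s   ≡⟨ *-assoc (suc (suc s)) u (u ^ s) ⟩
  suc (suc s) * (u * u ^ s) ∎
  where
  open ≤-Reasoning
  step : ∀ {s u} → s < u → suc u * suc s ≤ suc (suc s) * u
  step {s} (s≤s {n = u} s≤u) with w , refl ← m≤n⇒∃[o]m+o≡n s≤u =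
    ≤-trans (m≤m+n _ w) (≤-reflexive (expand s w))
    where
    expand : ∀ s w → suc (suc s + w) * suc s + w ≡ suc (suc s) * (suc s + w)
    expand = solve-∀

[1+q]^s≤[1+s]^q : ∀ {s q} → s ≤ q → suc q ^ s ≤ suc s ^ q
[1+q]^s≤[1+s]^q {s} s≤q with r , refl ← m≤n⇒∃[o]m+o≡n s≤q = go r
  where
  open ≤-Reasoning
  go : ∀ r → suc (s + r) ^ s ≤ suc s ^ (s + r)
  go zero    rewrite +-identityʳ s = ≤-refl
  go (suc r) = begin
    suc (s + suc r) ^ s     ≡⟨ cong (λ z → suc z ^ s) (+-suc s r) ⟩
    suc (suc (s + r)) ^ s   ≤⟨ [1+u]^s≤[1+s]*u^s s (suc (s + r)) (m≤n⇒m≤1+n (m≤m+n s r)) ⟩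
    suc s * suc (s + r) ^ s ≤⟨ *-monoʳ-≤ (suc s) (go r) ⟩
    suc s * suc s ^ (s + r) ≡⟨ cong (suc s ^_) (+-suc s r) ⟨
    suc s ^ (s + suc r)     ∎

[m*n]^o≡m^o*n^o : ∀ m n o → (m * n) ^ o ≡ m ^ o * n ^ o
[m*n]^o≡m^o*n^o m n zero    = refl
[m*n]^o≡m^o*n^o m n (suc o) rewrite [m*n]^o≡m^o*n^o m n o = *-interchange m n (m ^ o) (n ^ o)

alon-füredi-step : ∀ {k' n d t a b} → t ≤ k' → t ≤ d →
                   suc k' ^ (k' * n ∸ (d ∸ t)) ≤ a ^ k' → (suc k' ∸ t) * a ≤ b →
                   suc k' ^ (k' * suc n ∸ d) ≤ b ^ k'
alon-füredi-step {k'} {n} {d} {t} {a} {b} t≤k' t≤d a-bound b-bound = begin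
  suc k' ^ (k' * suc n ∸ d)                       ≤⟨ ^-monoʳ-≤ (suc k') exponent ⟩
  suc k' ^ ((k' ∸ t) + (k' * n ∸ (d ∸ t)))        ≡⟨ ^-distribˡ-+-* (suc k') (k' ∸ t) _ ⟩
  suc k' ^ (k' ∸ t) * suc k' ^ (k' * n ∸ (d ∸ t)) ≤⟨ *-mono-≤ ([1+q]^s≤[1+s]^q (m∸n≤m k' t)) a-bound ⟩
  suc (k' ∸ t) ^ k' * a ^ k'                      ≡⟨ [m*n]^o≡m^o*n^o (suc (k' ∸ t)) a k' ⟨
  (suc (k' ∸ t) * a) ^ k'                         ≤⟨ ^-monoˡ-≤ k' (subst (λ c → c * a ≤ b) k∸t≡1+k'∸t b-bound) ⟩
  b ^ k'                                          ∎
  where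
  open ≤-Reasoning
  k∸t≡1+k'∸t : suc k' ∸ t ≡ suc (k' ∸ t)
  k∸t≡1+k'∸t = +-∸-assoc 1 t≤k'
  exponent : k' * suc n ∸ d ≤ (k' ∸ t) + (k' * n ∸ (d ∸ t))
  exponent = m≤n+o⇒m∸n≤o (k' * suc n) d (begin
    k' * suc n                                      ≡⟨ *-suc k' n ⟩
    k' + k' * n                                     ≤⟨ +-mono-≤ (≤-reflexive (sym (m+[n∸m]≡n t≤k')))
                                                                (m≤n+m∸n (k' * n) (d ∸ t)) ⟩
    t + (k' ∸ t) + ((d ∸ t) + (k' * n ∸ (d ∸ t)))   ≡⟨ +-interchange t (k' ∸ t) (d ∸ t) _ ⟩
    t + (d ∸ t) + ((k' ∸ t) + (k' * n ∸ (d ∸ t)))   ≡⟨ cong (_+ ((k' ∸ t) + (k' * n ∸ (d ∸ t))))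
                                                            (m+[n∸m]≡n t≤d) ⟩
    d + ((k' ∸ t) + (k' * n ∸ (d ∸ t)))             ∎)

module _ {A : Set} where

  count : {P : Pred A 0ℓ} → Decidable P → List A → ℕ
  count P? xs = length (filter P? xs)

  module _ {P : Pred A 0ℓ} (P? : Decidable P) where

    count-none : (∀ x → ¬ P x) → ∀ xs → count P? xs ≡ 0
    count-none ¬P xs = cong length (filter-none P? (universal ¬P xs))

    count-++ : ∀ xs ys → count P? (xs ++ ys) ≡ count P? xs + count P? ys
    count-++ xs ys = trans (cong length (filter-++ P? xs ys)) (length-++ (filter P? xs))

    count+count-∁≡length : ∀ xs → count P? xs + count (¬? ∘ P?) xs ≡ length xs
    count+count-∁≡length []       = refl
    count+count-∁≡length (x ∷ xs) with P? x
    ... | yes _ = cong suc (count+count-∁≡length xs)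
    ... | no  _ = trans (+-suc _ _) (cong suc (count+count-∁≡length xs))

    count-accept : ∀ {x} → P x → ∀ xs → count P? (x ∷ xs) ≡ suc (count P? xs)
    count-accept p xs = cong length (filter-accept P? p)

    count-≤-∷ : ∀ x xs → count P? xs ≤ count P? (x ∷ xs)
    count-≤-∷ x xs with P? x
    ... | yes _ = n≤1+n _
    ... | no  _ = ≤-refl

  count-≐ : {P Q : Pred A 0ℓ} (P? : Decidable P) (Q? : Decidable Q) →
            P ≐ Q → ∀ xs → count P? xs ≡ count Q? xs
  count-≐ P? Q? P≐Q xs = cong length (filter-≐ P? Q? P≐Q xs)

  count-≤-+ : {P Q R : Pred A 0ℓ} (P? : Decidable P) (Q? : Decidable Q) (R? : Decidable R) →
              (∀ {x} → P x → Q x ⊎ R x) → ∀ xs → count P? xs ≤ count Q? xs + count R? xs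
  count-≤-+ P? Q? R? P⊆Q∪R []       = z≤n
  count-≤-+ P? Q? R? P⊆Q∪R (x ∷ xs) with ih ← count-≤-+ P? Q? R? P⊆Q∪R xs | P? x
  ... | no _  = ≤-trans ih (+-mono-≤ (count-≤-∷ Q? x xs) (count-≤-∷ R? x xs))
  ... | yes p with P⊆Q∪R p
  ...   | inj₁ q rewrite count-accept Q? q xs = s≤s (≤-trans ih (+-monoʳ-≤ _ (count-≤-∷ R? x xs)))
  ...   | inj₂ r rewrite count-accept R? r xs =
    ≤-trans (s≤s (≤-trans ih (+-monoˡ-≤ _ (count-≤-∷ Q? x xs)))) (≤-reflexive (sym (+-suc _ _)))

count-map : {A B : Set} {P : Pred B 0ℓ} (P? : Decidable P) (f : A → B) →
            ∀ xs → count P? (map f xs) ≡ count (P? ∘ f) xs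
count-map P? f []       = refl
count-map P? f (x ∷ xs) with P? (f x)
... | yes _ = cong suc (count-map P? f xs)
... | no  _ = count-map P? f xs

length-allFin : ∀ k → length (allFin k) ≡ k
length-allFin zero    = refl
length-allFin (suc k) = cong suc (trans (length-map Fin.suc (allFin k)) (length-allFin k))

count-≡-allFin : ∀ {k} (z : Fin k) → count (_≟ z) (allFin k) ≤ 1
count-≡-allFin {suc k} Fin.zero rewrite count-map (_≟ Fin.zero) Fin.suc (allFin k)
  | count-none ((_≟ Fin.zero) ∘ Fin.suc) (λ _ ()) (allFin k) = ≤-refl
count-≡-allFin {suc k} (Fin.suc z) rewrite count-map (_≟ Fin.suc z) Fin.suc (allFin k) =
  ≤-trans (≤-reflexive (count-≐ _ (_≟ z) (suc-injective , cong Fin.suc) (allFin k))) (count-≡-allFin z)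

module Polynomials (k' : ℕ) (𝔽 : FiniteField (suc k')) where

  k : ℕ
  k = suc k'

  F : Set
  F = Fin k

  ring : CommutativeRing 0ℓ 0ℓ
  ring = record { Carrier = F ; _≈_ = _≡_ ; FiniteField 𝔽 }

  open CommutativeRing ring
    using (0#; 1#; commutativeSemiring)
    renaming ( _+_ to _⊕_; _*_ to _⊗_; -_ to ⊖_
             ; +-identityˡ to ⊕-identityˡ; +-identityʳ to ⊕-identityʳ; +-assoc to ⊕-assoc
             ; *-comm to ⊗-comm; *-assoc to ⊗-assoc; *-identityˡ to ⊗-identityˡ; *-identityʳ to ⊗-identityʳ
             ; zeroˡ to ⊗-zeroˡ; zeroʳ to ⊗-zeroʳ; -‿inverseʳ to ⊖-inverseʳ)
  open import Algebra.Properties.Ring (CommutativeRing.ring ring)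
    using () renaming (+-cancelˡ to ⊕-cancelˡ; +-cancelʳ to ⊕-cancelʳ; +-inverseˡ-unique to ⊖-unique)
  open import Algebra.Definitions.RawMonoid (CommutativeRing.*-rawMonoid ring) using () renaming (sum to product)
  open NaturalCoefficients commutativeSemiring using (solve; _:+_; _:*_; _:=_)

  1≢0 : 1# ≢ 0#
  1≢0 = FiniteField.0≢1 𝔽 ∘ sym

  ⊗-cancelʳ-≢0 : ∀ {a} x y → a ≢ 0# → x ⊗ a ≡ y ⊗ a → x ≡ y
  ⊗-cancelʳ-≢0 {a} x y a≢0 xa≡ya with b , ab≡1 ← FiniteField.inverse 𝔽 a a≢0 = begin
    x                ≡⟨ unit x ⟨
    x ⊗ a ⊗ b        ≡⟨ cong (_⊗ b) xa≡ya ⟩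
    y ⊗ a ⊗ b        ≡⟨ unit y ⟩
    y                ∎
    where
    open ≡-Reasoning
    unit : ∀ z → z ⊗ a ⊗ b ≡ z
    unit z = trans (⊗-assoc z a b) (trans (cong (z ⊗_) ab≡1) (⊗-identityʳ z))

  x⊗y≡0⇒x≡0⊎y≡0 : ∀ {x y} → x ⊗ y ≡ 0# → x ≡ 0# ⊎ y ≡ 0#
  x⊗y≡0⇒x≡0⊎y≡0 {x} {y} xy≡0 with y ≟ 0#
  ... | yes y≡0 = inj₂ y≡0
  ... | no  y≢0 = inj₁ (⊗-cancelʳ-≢0 x 0# y≢0 (trans xy≡0 (sym (⊗-zeroˡ y))))

  -- Univariate polynomial functions

  data HasDegree : ℕ → (F → F) → Set where
    const : ∀ {f} c → c ≢ 0# → (∀ y → f y ≡ c) → HasDegree 0 f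
    step  : ∀ {t f} c s g → HasDegree t g → (∀ y → f y ≡ c ⊕ (y ⊕ s) ⊗ g y) → HasDegree (suc t) f

  -- f y - f z = (y - z) q y, written without subtraction
  divide : ∀ {t f} → HasDegree (suc t) f → ∀ z →
           Σ[ q ∈ (F → F) ] HasDegree t q × (∀ y → f y ⊕ z ⊗ q y ≡ f z ⊕ y ⊗ q y)
  divide {f = f} (step c s g (const d d≢0 g≡d) f≡) z = g , const d d≢0 g≡d , λ y → begin
    f y ⊕ z ⊗ g y                     ≡⟨ cong (_⊕ z ⊗ g y) (f≡ y) ⟩
    c ⊕ (y ⊕ s) ⊗ g y ⊕ z ⊗ g y       ≡⟨ swap c y z s (g y) ⟩
    c ⊕ (z ⊕ s) ⊗ g y ⊕ y ⊗ g y       ≡⟨ cong (λ w → c ⊕ (z ⊕ s) ⊗ w ⊕ y ⊗ g y) (g-const y) ⟩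
    c ⊕ (z ⊕ s) ⊗ g z ⊕ y ⊗ g y       ≡⟨ cong (_⊕ y ⊗ g y) (f≡ z) ⟨
    f z ⊕ y ⊗ g y                     ∎
    where
    open ≡-Reasoning
    g-const : ∀ y → g y ≡ g z
    g-const y = trans (g≡d y) (sym (g≡d z))
    swap : ∀ c y z s g → c ⊕ (y ⊕ s) ⊗ g ⊕ z ⊗ g ≡ c ⊕ (z ⊕ s) ⊗ g ⊕ y ⊗ g
    swap = solve 5 (λ c y z s g → c :+ (y :+ s) :* g :+ z :* g := c :+ (z :+ s) :* g :+ y :* g) refl
  divide {f = f} (step c s g dg@(step _ _ _ _ _) f≡) z with q , dq , q≡ ← divide dg z =
    (λ y → g z ⊕ (y ⊕ s) ⊗ q y) , step (g z) s q dq (λ _ → refl) , λ y → begin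
    f y ⊕ z ⊗ (g z ⊕ (y ⊕ s) ⊗ q y)              ≡⟨ cong (_⊕ z ⊗ (g z ⊕ (y ⊕ s) ⊗ q y)) (f≡ y) ⟩
    c ⊕ (y ⊕ s) ⊗ g y ⊕ z ⊗ (g z ⊕ (y ⊕ s) ⊗ q y) ≡⟨ expand₁ c y z s (g y) (g z) (q y) ⟩
    c ⊕ z ⊗ g z ⊕ (y ⊕ s) ⊗ (g y ⊕ z ⊗ q y)       ≡⟨ cong (λ w → c ⊕ z ⊗ g z ⊕ (y ⊕ s) ⊗ w) (q≡ y) ⟩
    c ⊕ z ⊗ g z ⊕ (y ⊕ s) ⊗ (g z ⊕ y ⊗ q y)       ≡⟨ expand₂ c y z s (g z) (q y) ⟩
    c ⊕ (z ⊕ s) ⊗ g z ⊕ y ⊗ (g z ⊕ (y ⊕ s) ⊗ q y) ≡⟨ cong (_⊕ y ⊗ (g z ⊕ (y ⊕ s) ⊗ q y)) (f≡ z) ⟨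
    f z ⊕ y ⊗ (g z ⊕ (y ⊕ s) ⊗ q y)              ∎
    where
    open ≡-Reasoning
    expand₁ : ∀ c y z s gy gz qy →
              c ⊕ (y ⊕ s) ⊗ gy ⊕ z ⊗ (gz ⊕ (y ⊕ s) ⊗ qy) ≡ c ⊕ z ⊗ gz ⊕ (y ⊕ s) ⊗ (gy ⊕ z ⊗ qy)
    expand₁ = solve 7 (λ c y z s gy gz qy →
      c :+ (y :+ s) :* gy :+ z :* (gz :+ (y :+ s) :* qy) := c :+ z :* gz :+ (y :+ s) :* (gy :+ z :* qy)) refl
    expand₂ : ∀ c y z s gz qy →
              c ⊕ z ⊗ gz ⊕ (y ⊕ s) ⊗ (gz ⊕ y ⊗ qy) ≡ c ⊕ (z ⊕ s) ⊗ gz ⊕ y ⊗ (gz ⊕ (y ⊕ s) ⊗ qy)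
    expand₂ = solve 6 (λ c y z s gz qy →
      c :+ z :* gz :+ (y :+ s) :* (gz :+ y :* qy) := c :+ (z :+ s) :* gz :+ y :* (gz :+ (y :+ s) :* qy)) refl

  roots : (F → F) → ℕ
  roots f = count (λ y → f y ≟ 0#) (allFin k)

  nonroots : (F → F) → ℕ
  nonroots f = count (λ y → ¬? (f y ≟ 0#)) (allFin k)

  roots≤degree : ∀ {t f} → HasDegree t f → roots f ≤ t
  roots≤degree {f = f} (const c c≢0 f≡c) =
    ≤-reflexive (count-none (λ y → f y ≟ 0#) (λ y fy≡0 → c≢0 (trans (sym (f≡c y)) fy≡0)) (allFin k))
  roots≤degree {suc t} {f} df@(step _ _ _ _ _) with any? (λ y → f y ≟ 0#)
  ... | no no-root =
    ≤-trans (≤-reflexive (count-none (λ y → f y ≟ 0#) (λ y fy≡0 → no-root (y , fy≡0)) (allFin k))) z≤n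
  ... | yes (z , fz≡0) with q , dq , q≡ ← divide df z =
    ≤-trans (count-≤-+ (λ y → f y ≟ 0#) (_≟ z) (λ y → q y ≟ 0#) root-of-factor (allFin k))
            (+-mono-≤ (count-≡-allFin z) (roots≤degree dq))
    where
    root-of-factor : ∀ {y} → f y ≡ 0# → y ≡ z ⊎ q y ≡ 0#
    root-of-factor {y} fy≡0 with q y ≟ 0#
    ... | yes qy≡0 = inj₂ qy≡0
    ... | no  qy≢0 = inj₁ (⊗-cancelʳ-≢0 y z qy≢0 (begin
      y ⊗ q y       ≡⟨ ⊕-identityˡ _ ⟨
      0# ⊕ y ⊗ q y  ≡⟨ cong (_⊕ y ⊗ q y) fz≡0 ⟨
      f z ⊕ y ⊗ q y ≡⟨ q≡ y ⟨
      f y ⊕ z ⊗ q y ≡⟨ cong (_⊕ z ⊗ q y) fy≡0 ⟩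
      0# ⊕ z ⊗ q y  ≡⟨ ⊕-identityˡ _ ⟩
      z ⊗ q y       ∎))
      where open ≡-Reasoning

  k∸degree≤nonroots : ∀ {t f} → HasDegree t f → k ∸ t ≤ nonroots f
  k∸degree≤nonroots {t} {f} df = begin
    k ∸ t                              ≤⟨ ∸-monoʳ-≤ k (roots≤degree df) ⟩
    k ∸ roots f                        ≡⟨ cong (_∸ roots f) all-points ⟨
    roots f + nonroots f ∸ roots f     ≡⟨ m+n∸m≡n (roots f) (nonroots f) ⟩
    nonroots f                         ∎
    where
    open ≤-Reasoning
    all-points : roots f + nonroots f ≡ k
    all-points = trans (count+count-∁≡length (λ y → f y ≟ 0#) (allFin k)) (length-allFin k)

  newton : ∀ {L} → Vec F L → Vec F L → F → F
  newton []       []       y = 0#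
  newton (s ∷ ss) (c ∷ cs) y = c ⊕ (y ⊕ s) ⊗ newton ss cs y

  mutual
    newton-zeros : ∀ {L} (ss cs : Vec F L) → (∀ j → lookup cs j ≡ 0#) → ∀ y → newton ss cs y ≡ 0#
    newton-zeros []       []       _    y = refl
    newton-zeros (s ∷ ss) (c ∷ cs) cs≡0 y = trans (newton-∷-zeros s c ss cs (cs≡0 ∘ Fin.suc) y) (cs≡0 Fin.zero)

    newton-∷-zeros : ∀ {L} s c (ss cs : Vec F L) → (∀ j → lookup cs j ≡ 0#) →
                     ∀ y → newton (s ∷ ss) (c ∷ cs) y ≡ c
    newton-∷-zeros s c ss cs cs≡0 y = begin
      c ⊕ (y ⊕ s) ⊗ newton ss cs y ≡⟨ cong (λ b → c ⊕ (y ⊕ s) ⊗ b) (newton-zeros ss cs cs≡0 y) ⟩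
      c ⊕ (y ⊕ s) ⊗ 0#             ≡⟨ cong (c ⊕_) (⊗-zeroʳ _) ⟩
      c ⊕ 0#                       ≡⟨ ⊕-identityʳ c ⟩
      c                            ∎
      where open ≡-Reasoning

  VanishesAbove : ∀ {A : Set} {L} → (A → Set) → Fin L → Vec A L → Set
  VanishesAbove IsZero t as = ∀ j → t Fin.< j → IsZero (lookup as j)

  newton-hasDegree : ∀ {L} (ss cs : Vec F L) t → lookup cs t ≢ 0# → VanishesAbove (_≡ 0#) t cs →
                     HasDegree (toℕ t) (newton ss cs)
  newton-hasDegree (s ∷ ss) (c ∷ cs) Fin.zero c≢0 above =
    const c c≢0 (newton-∷-zeros s c ss cs λ j → above (Fin.suc j) z<s)
  newton-hasDegree (s ∷ ss) (c ∷ cs) (Fin.suc t) ct≢0 above =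
    step c s (newton ss cs) (newton-hasDegree ss cs t ct≢0 λ j t<j → above (Fin.suc j) (s<s t<j)) (λ _ → refl)

  -- Polynomial functions of bounded total degree

  Fn : ℕ → Set
  Fn n = Vec F n → F

  Zero : ∀ {n} → Fn n → Set
  Zero f = ∀ x → f x ≡ 0#

  nodes : Vec F k
  nodes = tabulate id

  node-cover : ∀ y → Any (λ s → y ⊕ s ≡ 0#) nodes
  node-cover y = tabulate⁺ {f = id} (⊖ y) (⊖-inverseʳ y)

  coefficientsAt : ∀ {n L} → Vec (Fn n) L → Vec F n → Vec F L
  coefficientsAt gs x = V.map (λ g → g x) gs

  zeros : ∀ {n L} → Vec (Fn n) L
  zeros = replicate _ (λ _ → 0#)

  coefficientsAt-zeros : ∀ {n L} (gs : Vec (Fn n) L) → (∀ j → Zero (lookup gs j)) →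
                         ∀ x j → lookup (coefficientsAt gs x) j ≡ 0#
  coefficientsAt-zeros gs gs≡0 x j = trans (lookup-map j _ gs) (gs≡0 j x)

  newton-vanishes : ∀ {n L} (ss : Vec F L) (gs : Vec (Fn n) L) → (∀ j → Zero (lookup gs j)) →
                    ∀ x y → newton ss (coefficientsAt gs x) y ≡ 0#
  newton-vanishes ss gs gs≡0 x = newton-zeros ss (coefficientsAt gs x) (coefficientsAt-zeros gs gs≡0 x)

  zeros-vanish : ∀ {n L} j → Zero (lookup (zeros {n} {L}) j)
  zeros-vanish j x = cong (λ g → g x) (lookup-replicate j (λ _ → 0#))

  Graded : ∀ {A : Set} {L} → (ℕ → A → Set) → ℕ → Vec A L → Set
  Graded P e []       = ⊤
  Graded P e (a ∷ as) = P e a × Graded P (pred e) as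

  module _ {A : Set} {P : ℕ → A → Set} where

    graded-lookup : ∀ {L e} {as : Vec A L} → Graded P e as → ∀ j → P (e ∸ toℕ j) (lookup as j)
    graded-lookup {as = a ∷ as} (pa , _)   Fin.zero    = pa
    graded-lookup {e = e} {as = a ∷ as} (_ , pas) (Fin.suc j) =
      subst (λ i → P i (lookup as j)) (pred-∸ e) (graded-lookup pas j)
      where
      pred-∸ : ∀ e → pred e ∸ toℕ j ≡ e ∸ suc (toℕ j)
      pred-∸ zero    = 0∸n≡0 (toℕ j)
      pred-∸ (suc e) = refl

    graded-replicate : ∀ {a} → (∀ e → P e a) → ∀ {L e} → Graded P e (replicate L a)
    graded-replicate pa {zero}  = tt
    graded-replicate pa {suc L} = pa _ , graded-replicate pa

    graded-map : ∀ {f : A → A} → (∀ {e a} → P e a → P e (f a)) →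
                 ∀ {L e} {as : Vec A L} → Graded P e as → Graded P e (V.map f as)
    graded-map pf {as = []}     _          = tt
    graded-map pf {as = a ∷ as} (pa , pas) = pf pa , graded-map pf pas

    graded-zipWith : ∀ {f : A → A → A} → (∀ {e a b} → P e a → P e b → P e (f a b)) →
                     ∀ {L e} {as bs : Vec A L} → Graded P e as → Graded P e bs → Graded P e (zipWith f as bs)
    graded-zipWith pf {as = []}     {[]}     _          _          = tt
    graded-zipWith pf {as = a ∷ as} {b ∷ bs} (pa , pas) (pb , pbs) = pf pa pb , graded-zipWith pf pas pbs

  -- Degree< e f: f is a polynomial function of total degree < e (the zero function when e = 0).
  -- In the first variable it is written in the Newton basis 1, (y + s₀), (y + s₀) (y + s₁), …
  -- over all k field elements, so every variable has degree below k; the basis may stop there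
  -- because the product of all (y + s) is y ^ k − y, which vanishes on F.
  Degree< : ∀ {n} → ℕ → Fn n → Set
  Degree< {zero}  zero    f = f [] ≡ 0#
  Degree< {zero}  (suc e) f = ⊤
  Degree< {suc n} e       f = Σ[ gs ∈ Vec (Fn n) k ]
    Graded Degree< e gs × (∀ y x → f (y ∷ x) ≡ newton nodes (coefficientsAt gs x) y)

  degree<-zero : ∀ {n e} {f : Fn n} → Zero f → Degree< e f
  degree<-zero {zero}  {zero}  f≡0 = f≡0 []
  degree<-zero {zero}  {suc e} f≡0 = tt
  degree<-zero {suc n} f≡0 = zeros , graded-replicate (λ _ → degree<-zero λ _ → refl) ,
    λ y x → trans (f≡0 (y ∷ x)) (sym (newton-vanishes nodes zeros zeros-vanish x y))

  degree<0⇒zero : ∀ {n} {f : Fn n} → Degree< 0 f → Zero f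
  degree<0⇒zero {zero}  f[]≡0 [] = f[]≡0
  degree<0⇒zero {suc n} (gs , graded , f≡) (y ∷ x) =
    trans (f≡ y x) (newton-vanishes nodes gs gs≡0 x y)
    where
    gs≡0 : ∀ j → Zero (lookup gs j)
    gs≡0 j = degree<0⇒zero (subst (λ e → Degree< e (lookup gs j)) (0∸n≡0 (toℕ j)) (graded-lookup graded j))

  degree<0-* : ∀ {n} (h : Fn n) {g} → Degree< 0 g → Degree< 0 (λ x → h x ⊗ g x)
  degree<0-* h dg = degree<-zero λ x → trans (cong (h x ⊗_) (degree<0⇒zero dg x)) (⊗-zeroʳ (h x))

  newton-+ : ∀ {n L} (ss : Vec F L) (gs hs : Vec (Fn n) L) x y →
             newton ss (coefficientsAt (zipWith (λ g h x → g x ⊕ h x) gs hs) x) y ≡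
             newton ss (coefficientsAt gs x) y ⊕ newton ss (coefficientsAt hs x) y
  newton-+ []       []       []       x y = sym (⊕-identityʳ 0#)
  newton-+ (s ∷ ss) (g ∷ gs) (h ∷ hs) x y =
    trans (cong (λ w → g x ⊕ h x ⊕ (y ⊕ s) ⊗ w) (newton-+ ss gs hs x y)) (distrib (g x) (h x) (y ⊕ s) _ _)
    where
    distrib : ∀ a b u A B → a ⊕ b ⊕ u ⊗ (A ⊕ B) ≡ a ⊕ u ⊗ A ⊕ (b ⊕ u ⊗ B)
    distrib = solve 5 (λ a b u A B → a :+ b :+ u :* (A :+ B) := a :+ u :* A :+ (b :+ u :* B)) refl

  newton-scale : ∀ {n L} (ss : Vec F L) c (gs : Vec (Fn n) L) x y →
                 newton ss (coefficientsAt (V.map (λ g x → c ⊗ g x) gs) x) y ≡ c ⊗ newton ss (coefficientsAt gs x) y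
  newton-scale []       c []       x y = sym (⊗-zeroʳ c)
  newton-scale (s ∷ ss) c (g ∷ gs) x y =
    trans (cong (λ w → c ⊗ g x ⊕ (y ⊕ s) ⊗ w) (newton-scale ss c gs x y)) (distrib c (g x) (y ⊕ s) _)
    where
    distrib : ∀ c a u A → c ⊗ a ⊕ u ⊗ (c ⊗ A) ≡ c ⊗ (a ⊕ u ⊗ A)
    distrib = solve 4 (λ c a u A → c :* a :+ u :* (c :* A) := c :* (a :+ u :* A)) refl

  degree<-+ : ∀ {n e} {f g : Fn n} → Degree< e f → Degree< e g → Degree< e (λ x → f x ⊕ g x)
  degree<-+ {zero}  {zero}  f[]≡0 g[]≡0 = trans (cong₂ _⊕_ f[]≡0 g[]≡0) (⊕-identityʳ 0#)
  degree<-+ {zero}  {suc e} _ _ = tt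
  degree<-+ {suc n} (gs , gs-graded , f≡) (hs , hs-graded , g≡) =
    zipWith (λ g h x → g x ⊕ h x) gs hs , graded-zipWith degree<-+ gs-graded hs-graded ,
    λ y x → trans (cong₂ _⊕_ (f≡ y x) (g≡ y x)) (sym (newton-+ nodes gs hs x y))

  degree<-scale : ∀ {n e} c {f : Fn n} → Degree< e f → Degree< e (λ x → c ⊗ f x)
  degree<-scale {zero}  {zero}  c f[]≡0 = trans (cong (c ⊗_) f[]≡0) (⊗-zeroʳ c)
  degree<-scale {zero}  {suc e} c _ = tt
  degree<-scale {suc n} c (gs , graded , f≡) =
    V.map (λ g x → c ⊗ g x) gs , graded-map (degree<-scale c) graded ,
    λ y x → trans (cong (c ⊗_) (f≡ y x)) (sym (newton-scale nodes c gs x y))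

  degree<-const : ∀ {n} c → Degree< {n} 1 (λ _ → c)
  degree<-const {zero}  c = tt
  degree<-const {suc n} c = (λ _ → c) ∷ zeros , (degree<-const c , graded-replicate λ _ → degree<-zero λ _ → refl) ,
    λ y x → sym (newton-∷-zeros Fin.zero c (V.tail nodes) (coefficientsAt zeros x) (coefficientsAt-zeros zeros zeros-vanish x) y)

  Affine : ∀ {n} → Fn n → Set
  Affine {zero}  f = ⊤
  Affine {suc n} f = Σ[ α ∈ F ] Σ[ l ∈ Fn n ] Affine l × (∀ y x → f (y ∷ x) ≡ α ⊗ y ⊕ l x)

  affine-const : ∀ {n} c → Affine {n} (λ _ → c)
  affine-const {zero}  c = tt
  affine-const {suc n} c = 0# , (λ _ → c) , affine-const c ,
    λ y x → sym (trans (cong (_⊕ c) (⊗-zeroˡ y)) (⊕-identityˡ c))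

  affine-lookup : ∀ {n} (u : Fin n) → Affine (λ v → lookup v u)
  affine-lookup {suc n} Fin.zero    = 1# , (λ _ → 0#) , affine-const 0# ,
    λ y x → sym (trans (⊕-identityʳ _) (⊗-identityˡ y))
  affine-lookup {suc n} (Fin.suc u) = 0# , (λ x → lookup x u) , affine-lookup u ,
    λ y x → sym (trans (cong (_⊕ lookup x u) (⊗-zeroˡ y)) (⊕-identityˡ _))

  affine-+ : ∀ {n} {f g : Fn n} → Affine f → Affine g → Affine (λ v → f v ⊕ g v)
  affine-+ {zero}  _ _ = tt
  affine-+ {suc n} (α , l , l-affine , f≡) (β , m , m-affine , g≡) =
    α ⊕ β , (λ x → l x ⊕ m x) , affine-+ l-affine m-affine ,
    λ y x → trans (cong₂ _⊕_ (f≡ y x) (g≡ y x)) (regroup α y (l x) β (m x))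
    where
    regroup : ∀ α y l β m → α ⊗ y ⊕ l ⊕ (β ⊗ y ⊕ m) ≡ (α ⊕ β) ⊗ y ⊕ (l ⊕ m)
    regroup = solve 5 (λ α y l β m → α :* y :+ l :+ (β :* y :+ m) := (α :+ β) :* y :+ (l :+ m)) refl

  affine-scale : ∀ {n} c {f : Fn n} → Affine f → Affine (λ v → c ⊗ f v)
  affine-scale {zero}  c _ = tt
  affine-scale {suc n} c (α , l , l-affine , f≡) =
    c ⊗ α , (λ x → c ⊗ l x) , affine-scale c l-affine ,
    λ y x → trans (cong (c ⊗_) (f≡ y x)) (distrib c α y (l x))
    where
    distrib : ∀ c α y l → c ⊗ (α ⊗ y ⊕ l) ≡ c ⊗ α ⊗ y ⊕ c ⊗ l
    distrib = solve 4 (λ c α y l → c :* (α :* y :+ l) := c :* α :* y :+ c :* l) refl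

  addHead : ∀ {n L} → Fn n → Vec (Fn n) L → Vec (Fn n) L
  addHead h []       = []
  addHead h (g ∷ gs) = (λ x → h x ⊕ g x) ∷ gs

  mulAffine : ∀ {n L} → F → Fn n → Vec F L → Vec (Fn n) L → Vec (Fn n) L
  mulAffine α l []       []       = []
  mulAffine α l (s ∷ ss) (g ∷ gs) =
    (λ x → (l x ⊕ α ⊗ ⊖ s) ⊗ g x) ∷ addHead (λ x → α ⊗ g x) (mulAffine α l ss gs)

  -- As the Newton basis is truncated, the product is only correct where some y + s vanishes.
  mulAffine-correct : ∀ {n L} α l (ss : Vec F L) (gs : Vec (Fn n) L) x y → Any (λ s → y ⊕ s ≡ 0#) ss →
    newton ss (coefficientsAt (mulAffine α l ss gs) x) y ≡ (α ⊗ y ⊕ l x) ⊗ newton ss (coefficientsAt gs x) y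
  mulAffine-correct α l (s ∷ ss) (g ∷ gs) x y (here y+s≡0) = begin
    (l x ⊕ α ⊗ ⊖ s) ⊗ g x ⊕ (y ⊕ s) ⊗ _ ≡⟨ vanish _ _ ⟩
    (l x ⊕ α ⊗ ⊖ s) ⊗ g x              ≡⟨ cong (λ w → (l x ⊕ α ⊗ w) ⊗ g x) (⊖-unique y s y+s≡0) ⟨
    (l x ⊕ α ⊗ y) ⊗ g x                ≡⟨ cong (_⊗ g x) (CommutativeRing.+-comm ring (l x) (α ⊗ y)) ⟩
    (α ⊗ y ⊕ l x) ⊗ g x                ≡⟨ cong ((α ⊗ y ⊕ l x) ⊗_) (vanish _ _) ⟨
    (α ⊗ y ⊕ l x) ⊗ (g x ⊕ (y ⊕ s) ⊗ newton ss (coefficientsAt gs x) y) ∎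
    where
    open ≡-Reasoning
    vanish : ∀ a b → a ⊕ (y ⊕ s) ⊗ b ≡ a
    vanish a b = trans (cong (λ u → a ⊕ u ⊗ b) y+s≡0) (trans (cong (a ⊕_) (⊗-zeroˡ b)) (⊕-identityʳ a))
  mulAffine-correct α l (s ∷ s′ ∷ ss) (g ∷ g′ ∷ gs) x y (there cover) = begin
    (l x ⊕ α ⊗ ⊖ s) ⊗ g x ⊕ (y ⊕ s) ⊗ (α ⊗ g x ⊕ h x ⊕ (y ⊕ s′) ⊗ H)
      ≡⟨ cong (λ w → (l x ⊕ α ⊗ ⊖ s) ⊗ g x ⊕ (y ⊕ s) ⊗ w) (⊕-assoc (α ⊗ g x) (h x) _) ⟩
    (l x ⊕ α ⊗ ⊖ s) ⊗ g x ⊕ (y ⊕ s) ⊗ (α ⊗ g x ⊕ newton (s′ ∷ ss) (coefficientsAt (mulAffine α l (s′ ∷ ss) (g′ ∷ gs)) x) y)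
      ≡⟨ cong (λ w → (l x ⊕ α ⊗ ⊖ s) ⊗ g x ⊕ (y ⊕ s) ⊗ (α ⊗ g x ⊕ w))
              (mulAffine-correct α l (s′ ∷ ss) (g′ ∷ gs) x y cover) ⟩
    (l x ⊕ α ⊗ ⊖ s) ⊗ g x ⊕ (y ⊕ s) ⊗ (α ⊗ g x ⊕ (α ⊗ y ⊕ l x) ⊗ N)
      ≡⟨ expand (l x) α (⊖ s) (g x) y s N ⟩
    (α ⊗ y ⊕ l x) ⊗ (g x ⊕ (y ⊕ s) ⊗ N) ⊕ α ⊗ g x ⊗ (s ⊕ ⊖ s)
      ≡⟨ cong (λ w → (α ⊗ y ⊕ l x) ⊗ (g x ⊕ (y ⊕ s) ⊗ N) ⊕ α ⊗ g x ⊗ w) (⊖-inverseʳ s) ⟩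
    (α ⊗ y ⊕ l x) ⊗ (g x ⊕ (y ⊕ s) ⊗ N) ⊕ α ⊗ g x ⊗ 0#
      ≡⟨ trans (cong ((α ⊗ y ⊕ l x) ⊗ (g x ⊕ (y ⊕ s) ⊗ N) ⊕_) (⊗-zeroʳ _)) (⊕-identityʳ _) ⟩
    (α ⊗ y ⊕ l x) ⊗ (g x ⊕ (y ⊕ s) ⊗ N) ∎
    where
    open ≡-Reasoning
    h = λ x → (l x ⊕ α ⊗ ⊖ s′) ⊗ g′ x
    H = newton ss (coefficientsAt (addHead (λ x → α ⊗ g′ x) (mulAffine α l ss gs)) x) y
    N = newton (s′ ∷ ss) (coefficientsAt (g′ ∷ gs) x) y
    expand : ∀ l α ns g y s N → (l ⊕ α ⊗ ns) ⊗ g ⊕ (y ⊕ s) ⊗ (α ⊗ g ⊕ (α ⊗ y ⊕ l) ⊗ N)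
                              ≡ (α ⊗ y ⊕ l) ⊗ (g ⊕ (y ⊕ s) ⊗ N) ⊕ α ⊗ g ⊗ (s ⊕ ns)
    expand = solve 7 (λ l α ns g y s N → (l :+ α :* ns) :* g :+ (y :+ s) :* (α :* g :+ (α :* y :+ l) :* N)
                                     := (α :* y :+ l) :* (g :+ (y :+ s) :* N) :+ α :* g :* (s :+ ns)) refl

  graded-addHead : ∀ {n L e} {h : Fn n} {gs : Vec (Fn n) L} →
                   Degree< e h → Graded Degree< e gs → Graded Degree< e (addHead h gs)
  graded-addHead {gs = []}     _  _          = tt
  graded-addHead {gs = g ∷ gs} dh (dg , dgs) = degree<-+ dh dg , dgs

  graded-mulAffine0 : ∀ {n L α} {l : Fn n} {ss : Vec F L} {gs} →
                      Graded Degree< 0 gs → Graded Degree< 0 (mulAffine α l ss gs)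
  graded-mulAffine0 {ss = []}     {[]}     _          = tt
  graded-mulAffine0 {α = α} {ss = s ∷ ss} {g ∷ gs} (dg , dgs) =
    degree<0-* _ dg , graded-addHead (degree<-scale α dg) (graded-mulAffine0 dgs)

  mutual
    degree<-*affine : ∀ {n e} {ℓ f : Fn n} → Affine ℓ → Degree< e f → Degree< (suc e) (λ x → ℓ x ⊗ f x)
    degree<-*affine {zero}  _ _ = tt
    degree<-*affine {suc n} (α , l , l-affine , ℓ≡) (gs , graded , f≡) =
      mulAffine α l nodes gs , graded-mulAffine l-affine graded ,
      λ y x → trans (cong₂ _⊗_ (ℓ≡ y x) (f≡ y x)) (sym (mulAffine-correct α l nodes gs x y (node-cover y)))

    graded-mulAffine : ∀ {n L e α} {l : Fn n} {ss : Vec F L} {gs} → Affine l →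
                       Graded Degree< e gs → Graded Degree< (suc e) (mulAffine α l ss gs)
    graded-mulAffine {ss = []} {[]} _ _ = tt
    graded-mulAffine {e = e} {α} {l} {s ∷ ss} {g ∷ gs} l-affine (dg , dgs) =
      degree<-*affine (affine-+ l-affine (affine-const (α ⊗ ⊖ s))) dg ,
      graded-addHead (degree<-scale α dg) (rest e dgs)
      where
      rest : ∀ e → Graded Degree< (pred e) gs → Graded Degree< e (mulAffine α l ss gs)
      rest zero    = graded-mulAffine0
      rest (suc e) = graded-mulAffine l-affine

  product≢0 : ∀ {m} (a : Fin m → F) → (∀ i → a i ≢ 0#) → product a ≢ 0#
  product≢0 {zero}  a _   = 1≢0
  product≢0 {suc m} a a≢0 prod≡0 with x⊗y≡0⇒x≡0⊎y≡0 prod≡0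
  ... | inj₁ head≡0 = a≢0 Fin.zero head≡0
  ... | inj₂ tail≡0 = product≢0 (a ∘ Fin.suc) (a≢0 ∘ Fin.suc) tail≡0

  product≢0⇒≢0 : ∀ {m} (a : Fin m → F) → product a ≢ 0# → ∀ i → a i ≢ 0#
  product≢0⇒≢0 {suc m} a prod≢0 Fin.zero    head≡0 =
    prod≢0 (trans (cong (_⊗ product (a ∘ Fin.suc)) head≡0) (⊗-zeroˡ _))
  product≢0⇒≢0 {suc m} a prod≢0 (Fin.suc i) =
    product≢0⇒≢0 (a ∘ Fin.suc) (λ tail≡0 → prod≢0 (trans (cong (a Fin.zero ⊗_) tail≡0) (⊗-zeroʳ _))) i

  degree<-product : ∀ {n m} (h : Fin m → Fn n) → (∀ i → Affine (h i)) →
                    Degree< (suc m) (λ x → product (λ i → h i x))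
  degree<-product {m = zero}  h _        = degree<-const 1#
  degree<-product {m = suc m} h h-affine =
    degree<-*affine (h-affine Fin.zero) (degree<-product (h ∘ Fin.suc) (h-affine ∘ Fin.suc))

  -- The Alon–Füredi bound

  nonzeros : ∀ {n} → Fn n → ℕ
  nonzeros {n} f = count (λ x → ¬? (f x ≟ 0#)) (allVecs n k)

  nonroots-cong : ∀ {f g : F → F} → (∀ y → f y ≡ g y) → nonroots f ≡ nonroots g
  nonroots-cong {f} {g} f≡g = count-≐ (λ y → ¬? (f y ≟ 0#)) (λ y → ¬? (g y ≟ 0#))
    ((λ {y} fy≢0 → fy≢0 ∘ trans (f≡g y)) , (λ {y} gy≢0 → gy≢0 ∘ trans (sym (f≡g y)))) (allFin k)

  nonzeros-fibres : ∀ {n} (f : Fn (suc n)) (g : Fn n) c →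
                    (∀ x → g x ≢ 0# → c ≤ nonroots (λ y → f (y ∷ x))) → c * nonzeros g ≤ nonzeros f
  nonzeros-fibres {n} f g c fibre = go (allVecs n k)
    where
    go : ∀ xs → c * count (λ x → ¬? (g x ≟ 0#)) xs ≤
                count (λ v → ¬? (f v ≟ 0#)) (concatMap (λ x → map (_∷ x) (allFin k)) xs)
    go []       = ≤-reflexive (*-zeroʳ c)
    go (x ∷ xs) rewrite count-++ (λ v → ¬? (f v ≟ 0#)) (map (_∷ x) (allFin k))
                                 (concatMap (λ x → map (_∷ x) (allFin k)) xs)
                      | count-map (λ v → ¬? (f v ≟ 0#)) (_∷ x) (allFin k)
                with g x ≟ 0#
    ... | yes _    = ≤-trans (go xs) (m≤n+m _ _)
    ... | no gx≢0  = ≤-trans (≤-reflexive (*-suc c _)) (+-mono-≤ (fibre x gx≢0) (go xs))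

  nonzero? : ∀ {n} (g : Fn n) → Dec (∃ λ x → g x ≢ 0#)
  nonzero? {zero}  g = map′ ([] ,_) (λ { ([] , g[]≢0) → g[]≢0 }) (¬? (g [] ≟ 0#))
  nonzero? {suc n} g = map′ (λ (y , x , gyx≢0) → y ∷ x , gyx≢0) (λ { (y ∷ x , gyx≢0) → y , x , gyx≢0 })
                            (any? λ y → nonzero? (λ x → g (y ∷ x)))

  top-coefficient : ∀ {n L} (gs : Vec (Fn n) L) →
    (∀ j → Zero (lookup gs j)) ⊎ (Σ[ t ∈ Fin L ] (∃ λ x → lookup gs t x ≢ 0#) × VanishesAbove Zero t gs)
  top-coefficient []       = inj₁ λ ()
  top-coefficient (g ∷ gs) with top-coefficient gs
  ... | inj₂ (t , nonzero , above) = inj₂ (Fin.suc t , nonzero , λ { (Fin.suc j) (s<s t<j) → above j t<j })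
  ... | inj₁ gs≡0 with nonzero? g
  ...   | yes nonzero = inj₂ (Fin.zero , nonzero , λ { (Fin.suc j) _ → gs≡0 j })
  ...   | no  g≡0     = inj₁ λ { Fin.zero x → decidable-stable (g x ≟ 0#) (λ gx≢0 → g≡0 (x , gx≢0))
                               ; (Fin.suc j) → gs≡0 j }

  alon-füredi : ∀ {n d} {f : Fn n} → Degree< (suc d) f → (∃ λ x → f x ≢ 0#) → k ^ (k' * n ∸ d) ≤ nonzeros f ^ k'
  alon-füredi {zero} {d} {f} _ ([] , f≢0) with f [] ≟ 0#
  ... | yes f≡0 = contradiction f≡0 f≢0
  ... | no  _   rewrite *-zeroʳ k' | 0∸n≡0 d | ^-zeroˡ k' = ≤-refl
  alon-füredi {suc n} {d} {f} (gs , graded , f≡) (y₀ ∷ x₀ , f≢0) with top-coefficient gs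
  ... | inj₁ gs≡0 = contradiction (trans (f≡ y₀ x₀) (newton-vanishes nodes gs gs≡0 x₀ y₀)) f≢0
  ... | inj₂ (t , (x₁ , gₜx₁≢0) , above) =
    alon-füredi-step (toℕ≤pred[n] t) t≤d (alon-füredi gₜ-degree (x₁ , gₜx₁≢0))
                     (nonzeros-fibres f gₜ (k ∸ toℕ t) fibre)
    where
    gₜ : Fn n
    gₜ = lookup gs t
    gₜ-degree′ : Degree< (suc d ∸ toℕ t) gₜ
    gₜ-degree′ = graded-lookup graded t
    t≤d : toℕ t ≤ d
    t≤d with toℕ t ≤? d
    ... | yes t≤d = t≤d
    ... | no  t≰d = contradiction (degree<0⇒zero (subst (λ e → Degree< e gₜ) (m≤n⇒m∸n≡0 (≰⇒> t≰d)) gₜ-degree′) x₁)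
                                  gₜx₁≢0
    gₜ-degree : Degree< (suc (d ∸ toℕ t)) gₜ
    gₜ-degree = subst (λ e → Degree< e gₜ) (+-∸-assoc 1 t≤d) gₜ-degree′
    fibre : ∀ x → gₜ x ≢ 0# → k ∸ toℕ t ≤ nonroots (λ y → f (y ∷ x))
    fibre x gₜx≢0 = subst (k ∸ toℕ t ≤_) (nonroots-cong (λ y → sym (f≡ y x)))
      (k∸degree≤nonroots (newton-hasDegree nodes (coefficientsAt gs x) t
        (gₜx≢0 ∘ trans (sym (lookup-map t _ gs)))
        (λ j t<j → trans (lookup-map j _ gs) (above j t<j x))))

  -- Linear permutations and proper colourings

  module _ {π a b c} (a,b≢0 : ¬ (a ≡ 0# × b ≡ 0#)) (covers : Covers 𝔽 a b c π) where

    covering-coefficient≢0 : b ≢ 0#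
    covering-coefficient≢0 b≡0 = a,b≢0 (a≡0 , b≡0)
      where
      form : ∀ x → a ⊗ x ⊕ c ≡ 0#
      form x = trans (cong (a ⊗ x ⊕_) (sym (trans (cong (λ b → b ⊗ apply π x ⊕ c) b≡0)
                                                   (trans (cong (_⊕ c) (⊗-zeroˡ _)) (⊕-identityˡ c)))))
                     (covers x)
      c≡0 : c ≡ 0#
      c≡0 = trans (sym (trans (cong (_⊕ c) (⊗-zeroʳ a)) (⊕-identityˡ c))) (form 0#)
      a≡0 : a ≡ 0#
      a≡0 = trans (sym (trans (cong₂ _⊕_ (⊗-identityʳ a) c≡0) (⊕-identityʳ a))) (form 1#)

    covering-form≡0⇒apply≡ : ∀ x w → a ⊗ x ⊕ (b ⊗ w ⊕ c) ≡ 0# → apply π x ≡ w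
    covering-form≡0⇒apply≡ x w form≡0 = ⊗-cancelʳ-≢0 (apply π x) w covering-coefficient≢0 (begin
      apply π x ⊗ b ≡⟨ ⊗-comm _ b ⟩
      b ⊗ apply π x ≡⟨ ⊕-cancelʳ c _ _ (⊕-cancelˡ (a ⊗ x) _ _ (trans (covers x) (sym form≡0))) ⟩
      b ⊗ w         ≡⟨ ⊗-comm b w ⟩
      w ⊗ b         ∎)
      where open ≡-Reasoning

    apply≡⇒covering-form≡0 : ∀ x w → apply π x ≡ w → a ⊗ x ⊕ (b ⊗ w ⊕ c) ≡ 0#
    apply≡⇒covering-form≡0 x w πx≡w = subst (λ w → a ⊗ x ⊕ (b ⊗ w ⊕ c) ≡ 0#) πx≡w (covers x)

  module Labelled {S : Perm k → Set} (linear : ∀ π → S π → IsLinear 𝔽 π)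
                  {n} {G : Multigraph n} (ℓ : Labeling S G) where

    edgeForm : Fin (numEdges G) → Fn n
    edgeForm i v = let (a , b , c , _) = linear (σ ℓ i) (σ∈S ℓ i) ; (u , w) = arc ℓ i in
      a ⊗ lookup v u ⊕ (b ⊗ lookup v w ⊕ c)

    edgeForm-affine : ∀ i → Affine (edgeForm i)
    edgeForm-affine i = let (a , b , c , _) = linear (σ ℓ i) (σ∈S ℓ i) ; (u , w) = arc ℓ i in
      affine-+ (affine-scale a (affine-lookup u))
               (affine-+ (affine-scale b (affine-lookup w)) (affine-const c))

    Conflict : Fin (numEdges G) → Vec F n → Set
    Conflict i v = apply (σ ℓ i) (lookup v (proj₁ (arc ℓ i))) ≡ lookup v (proj₂ (arc ℓ i))

    edgeForm≡0⇒conflict : ∀ i v → edgeForm i v ≡ 0# → Conflict i v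
    edgeForm≡0⇒conflict i v = let (a , b , c , a,b≢0 , covers) = linear (σ ℓ i) (σ∈S ℓ i) in
      covering-form≡0⇒apply≡ {σ ℓ i} {a} {b} {c} a,b≢0 covers _ _

    conflict⇒edgeForm≡0 : ∀ i v → Conflict i v → edgeForm i v ≡ 0#
    conflict⇒edgeForm≡0 i v = let (a , b , c , a,b≢0 , covers) = linear (σ ℓ i) (σ∈S ℓ i) in
      apply≡⇒covering-form≡0 {σ ℓ i} {a} {b} {c} a,b≢0 covers _ _

    edgeProduct : Fn n
    edgeProduct v = product (λ i → edgeForm i v)

    proper⇒edgeProduct≢0 : ∀ v → Proper ℓ (lookup v) → edgeProduct v ≢ 0#
    proper⇒edgeProduct≢0 v proper = product≢0 (λ i → edgeForm i v) λ i → proper i ∘ edgeForm≡0⇒conflict i v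

    edgeProduct≢0⇒proper : ∀ v → edgeProduct v ≢ 0# → Proper ℓ (lookup v)
    edgeProduct≢0⇒proper v product≢0 i = product≢0⇒≢0 (λ i → edgeForm i v) product≢0 i ∘ conflict⇒edgeForm≡0 i v

    numProper≡nonzeros : numProper ℓ ≡ nonzeros edgeProduct
    numProper≡nonzeros = count-≐ (λ v → proper? ℓ (lookup v)) (λ v → ¬? (edgeProduct v ≟ 0#))
      ((λ {v} → proper⇒edgeProduct≢0 v) , (λ {v} → edgeProduct≢0⇒proper v)) (allVecs n k)

    numProper-bound : (κ : Fin n → F) → Proper ℓ κ → k ^ (k' * n ∸ numEdges G) ≤ numProper ℓ ^ k'
    numProper-bound κ proper = subst (λ N → k ^ (k' * n ∸ numEdges G) ≤ N ^ k') (sym numProper≡nonzeros)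
      (alon-füredi (degree<-product edgeForm edgeForm-affine)
                   (tabulate κ , proper⇒edgeProduct≢0 (tabulate κ) proper′))
      where
      proper′ : Proper ℓ (lookup (tabulate κ))
      proper′ i rewrite lookup∘tabulate κ (proj₁ (arc ℓ i)) | lookup∘tabulate κ (proj₂ (arc ℓ i)) = proper i

theorem1p3 : (k : ℕ) → IsPrimePower k → (F : FiniteField k) →
    (S : Perm k → Set) → (∀ π → S π → IsLinear F π) → Σ (Perm k) S →
    (n : ℕ) (G : Multigraph n) → Colorable S G →
    numEdges G ≤ (k ∸ 1) * n →
    (ℓ : Labeling S G) →
    k ^ ((k ∸ 1) * n ∸ numEdges G) ≤ numProper ℓ ^ (k ∸ 1)
theorem1p3 zero     _ 𝔽 _ _      _ _ _ _          _ _ = ⊥-elim (¬Fin0 (FiniteField.0# 𝔽))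
theorem1p3 (suc k') _ 𝔽 _ linear _ _ _ colourable _ ℓ =
  let (κ , proper) = colourable ℓ in Polynomials.Labelled.numProper-bound k' 𝔽 linear ℓ κ proper
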